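{- Let $\sigma\in 2^{<\omega}$, let $g:\omega\to\omega$, and let $\Phi$ be a Turing functional such that \[ (\forall n)(\forall \tau\succeq\sigma)(\exists\rho\succeq\tau)\bigl(\Phi^\rho(n)\downarrow \text{ and } \rho(g(n)) = \Phi^\rho(n)\bigr). \] Then for every finite string $\rho\succeq\sigma$ and every $n$, if $\Phi^\rho(n)\downarrow$ then $g(n)<|\rho|$.
   Context: $2^{<\omega}$ is the set of finite binary strings; $\sigma\preceq\tau$ means $\sigma$ is a prefix of $\tau$, and $|\rho|$ is the length of $\rho$. For a finite string $\rho$, $\Phi^\rho(n)\downarrow$ means the computation of $\Phi$ with oracle $\rho$ on input $n$ halts, querying the oracle only at positions $<|\rho|$; the condition $\rho(g(n))=\Phi^\rho(n)$ in particular requires $\rho(g(n))$ to be defined, i.e. $g(n)<|\rho|$. -}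

module Defs where

open import Data.Nat using (ℕ; zero; suc)
open import Data.Bool using (Bool; true; false)
open import Data.List using (List; []; _∷_; _++_)
open import Data.Maybe using (Maybe; just; nothing)
open import Data.Product using (∃-syntax)
open import Relation.Binary.PropositionalEquality using (_≡_)

Str : Set
Str = List Bool

_≼_ : Str → Str → Set
σ ≼ τ = ∃[ δ ] σ ++ δ ≡ τ

_!?_ : Str → ℕ → Maybe Bool
[]      !? _     = nothing
(b ∷ ρ) !? zero  = just b
(b ∷ ρ) !? suc i = ρ !? i

bit : Bool → ℕ
bit false = 0
bit true  = 1

-- Oracle machines (oracle query strategies): given the list of oracle
-- answers received so far, the machine either halts with an output or
-- queries the oracle at some position. (Non-termination = querying forever.)
data Action : Set where
  halt  : ℕ → Action
  query : ℕ → Action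

Machine : Set
Machine = List Bool → Action

TuringFunctional : Set
TuringFunctional = ℕ → Machine

-- Runs ρ M h v : continuing M from answer history h with finite oracle ρ,
-- the computation halts with output v, querying the oracle only at
-- positions < |ρ|.
data Runs (ρ : Str) (M : Machine) : List Bool → ℕ → Set where
  r-halt  : ∀ {h v} → M h ≡ halt v → Runs ρ M h v
  r-query : ∀ {h i b v} → M h ≡ query i → ρ !? i ≡ just b →
            Runs ρ M (h ++ b ∷ []) v → Runs ρ M h v

Halts : Str → Machine → ℕ → Set
Halts ρ M v = Runs ρ M [] v

_^_⟨_⟩≡_ : TuringFunctional → Str → ℕ → ℕ → Set
Φ ^ ρ ⟨ n ⟩≡ v = Halts ρ (Φ n) v

_^_⟨_⟩↓ : TuringFunctional → Str → ℕ → Set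
Φ ^ ρ ⟨ n ⟩↓ = ∃[ v ] Φ ^ ρ ⟨ n ⟩≡ v

module Submission where

-- If Φ^ρ(n) halted with g(n) ≥ |ρ|, extend ρ to a τ whose bit at g(n) is
-- different from Φ^ρ(n). Every ρ' ⪰ τ gives Φ^ρ'(n) = Φ^ρ(n) by use
-- monotonicity, while ρ'(g(n)) = τ(g(n)) ≠ Φ^ρ(n); this contradicts the
-- hypothesis applied to τ.

open import Defs
open import Data.Nat using (ℕ; zero; suc; _+_; _∸_; _≤_; _<_; _<?_)
open import Data.Nat.Properties using (≮⇒≥; m+[n∸m]≡n)
open import Data.Bool using (Bool; true; false)
open import Data.List using ([]; _∷_; _++_; length; replicate)
open import Data.List.Properties using (++-assoc)
open import Data.Maybe using (just)
open import Data.Maybe.Properties using (just-injective)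
open import Data.Product using (∃-syntax; _×_; _,_)
open import Relation.Nullary using (¬_; yes; no; contradiction)
open import Relation.Binary.PropositionalEquality
  using (_≡_; refl; sym; trans; cong; subst)

≼-trans : ∀ {ρ τ υ : Str} → ρ ≼ τ → τ ≼ υ → ρ ≼ υ
≼-trans {ρ} (δ , refl) (ε , refl) = δ ++ ε , sym (++-assoc ρ δ ε)

!?-++ʳ : ∀ (ρ δ : Str) i {b} → ρ !? i ≡ just b → (ρ ++ δ) !? i ≡ just b
!?-++ʳ (_ ∷ ρ) δ zero    eq = eq
!?-++ʳ (_ ∷ ρ) δ (suc i) eq = !?-++ʳ ρ δ i eq

!?-≼ : ∀ {ρ τ : Str} i {b} → ρ ≼ τ → ρ !? i ≡ just b → τ !? i ≡ just b
!?-≼ {ρ} i (δ , refl) = !?-++ʳ ρ δ i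

!?-after-padding : ∀ (ρ : Str) k c →
  (ρ ++ replicate k false ++ c ∷ []) !? (length ρ + k) ≡ just c
!?-after-padding []      zero    c = refl
!?-after-padding []      (suc k) c = !?-after-padding [] k c
!?-after-padding (_ ∷ ρ) k       c = !?-after-padding ρ k c

≼-with-bit-at : ∀ (ρ : Str) {i} → length ρ ≤ i → ∀ c →
  ∃[ τ ] (ρ ≼ τ × τ !? i ≡ just c)
≼-with-bit-at ρ {i} |ρ|≤i c =
  ρ ++ padding , (padding , refl) ,
  subst (λ j → (ρ ++ padding) !? j ≡ just c) (m+[n∸m]≡n |ρ|≤i)
        (!?-after-padding ρ (i ∸ length ρ) c)
  where padding = replicate (i ∸ length ρ) false ++ c ∷ []

Runs-++ʳ : ∀ {ρ M h v} δ → Runs ρ M h v → Runs (ρ ++ δ) M h v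
Runs-++ʳ δ (r-halt halts)             = r-halt halts
Runs-++ʳ {ρ} δ (r-query {i = i} asks answer run) =
  r-query asks (!?-++ʳ ρ δ i answer) (Runs-++ʳ δ run)

Runs-≼ : ∀ {ρ τ M h v} → ρ ≼ τ → Runs ρ M h v → Runs τ M h v
Runs-≼ (δ , refl) = Runs-++ʳ δ

Runs-deterministic : ∀ {ρ M h v w} → Runs ρ M h v → Runs ρ M h w → v ≡ w
Runs-deterministic (r-halt x) (r-halt y) with trans (sym x) y
... | refl = refl
Runs-deterministic (r-halt x) (r-query y _ _) with trans (sym x) y
... | ()
Runs-deterministic (r-query x _ _) (r-halt y) with trans (sym x) y
... | ()
Runs-deterministic (r-query x a r) (r-query y a′ r′) with trans (sym x) y
... | refl with just-injective (trans (sym a) a′)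
... | refl = Runs-deterministic r r′

output-≼ : ∀ {ρ τ M v w} → ρ ≼ τ → Halts ρ M v → Halts τ M w → v ≡ w
output-≼ ρ≼τ run = Runs-deterministic (Runs-≼ ρ≼τ run)

flipBit : ℕ → Bool
flipBit zero    = true
flipBit (suc _) = false

bit-flipBit : ∀ v → ¬ bit (flipBit v) ≡ v
bit-flipBit zero    ()
bit-flipBit (suc _) ()

lemma2p2 : (σ : Str) (g : ℕ → ℕ) (Φ : TuringFunctional) →
    (∀ (n : ℕ) (τ : Str) → σ ≼ τ →
      ∃[ ρ ] (τ ≼ ρ × ∃[ v ] (Φ ^ ρ ⟨ n ⟩≡ v × ∃[ b ] (ρ !? g n ≡ just b × bit b ≡ v)))) →
    ∀ (ρ : Str) (n : ℕ) → σ ≼ ρ → Φ ^ ρ ⟨ n ⟩↓ → g n < length ρ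
lemma2p2 σ g Φ H ρ n σ≼ρ (v , Φρ≡v) with g n <? length ρ
... | yes g<|ρ| = g<|ρ|
... | no  g≮|ρ| with ≼-with-bit-at ρ (≮⇒≥ g≮|ρ|) (flipBit v)
... | τ , ρ≼τ , τ[g]≡flip with H n τ (≼-trans σ≼ρ ρ≼τ)
... | ρ′ , τ≼ρ′ , w , Φρ′≡w , b , ρ′[g]≡b , b≡w =
  contradiction (trans (cong bit flip≡b) (trans b≡w (sym v≡w))) (bit-flipBit v)
  where
  v≡w : v ≡ w
  v≡w = output-≼ (≼-trans ρ≼τ τ≼ρ′) Φρ≡v Φρ′≡w
  flip≡b : flipBit v ≡ b
  flip≡b = just-injective (trans (sym (!?-≼ (g n) τ≼ρ′ τ[g]≡flip)) ρ′[g]≡b)
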